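{- Let $\ell\ge r\ge 3$ and $s\ge 1$ be integers and $n>s$. Let $A$ be a set of $s$ vertices and $B$ a disjoint set of $n-s$ vertices. (a) If $2+\binom{\ell-1}{2}\leq s< r+\binom{\ell-1}{2}$, fix $u\in A$ and let $\mathcal{G}_1$ be the $r$-graph on $A\cup B$ whose hyperedges are all $r$-sets containing exactly one vertex of $A$, together with all $r$-sets containing $u$ and at least $s-\binom{\ell-1}{2}$ other vertices of $A$. Then $\mathcal{G}_1$ is $K_{\ell+1}^{(r)+}$-free. (b) If $2\leq t\leq \ell-2$ and $\ell+1-t+\binom{t}{2}\leq s< \ell-t+\binom{t+1}{2}$, partition $A$ into $\ell-t$ parts $A_1,\dots,A_{\ell-t}$, each of size $\lfloor\frac{s}{\ell-t}\rfloor$ or $\lceil\frac{s}{\ell-t}\rceil$, and let $\mathcal{G}_2(t)$ be the $r$-graph on $A\cup B$ whose hyperedges are all $r$-sets containing exactly one vertex of $A$, together with all $r$-sets of the form $\{u_i,u_j\}\cup S$ where $u_i\in A_i$, $u_j\in A_j$ with $i\neq j$, and $S$ is an $(r-2)$-subset of $B$. Then $\mathcal{G}_2(t)$ is $K_{\ell+1}^{(r)+}$-free. (c) If $s<\ell$, let $\mathcal{G}_3$ be the $r$-graph on $A\cup B$ whose hyperedges are all $r$-sets containing at least one vertex of $A$. Then $\mathcal{G}_3$ is $K_{\ell+1}^{(r)+}$-free.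
   Context: An $r$-graph is an $r$-uniform hypergraph. $K_{\ell+1}^{(r)+}$ is the $r$-expansion of the complete graph $K_{\ell+1}$: each edge of $K_{\ell+1}$ is enlarged by $r-2$ new vertices, all new vertices distinct from each other and from the $\ell+1$ original (core) vertices. An $r$-graph is $\mathcal{F}$-free if it contains no subhypergraph isomorphic to $\mathcal{F}$. -}

module Defs where

open import Data.Nat using (ℕ; zero; suc; _+_; _*_; _∸_; _≤_; _<_; _/_)
open import Data.Fin using (Fin)
open import Data.Fin.Subset using (Subset; _∈_; _∉_; _∩_; ∣_∣)
open import Data.Product using (Σ; Σ-syntax; _×_; ∃; ∃-syntax; proj₁; proj₂; _,_)
open import Data.Sum using (_⊎_; inj₁; inj₂)
open import Data.Vec using (tabulate)
open import Relation.Nullary.Decidable using (⌊_⌋)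
open import Data.Nat.Combinatorics using (_C_)
open import Function.Bundles using (_⇔_)
open import Function.Definitions using (Injective)
open import Relation.Binary.PropositionalEquality using (_≡_; _≢_)
open import Relation.Nullary using (¬_)
import Data.Fin as F

-- An r-graph on vertex set Fin n is given by its edge predicate on subsets.
-- (Uniformity is built into each concrete construction below: every edge has
-- exactly r vertices.)
RGraph : ℕ → Set₁
RGraph n = Subset n → Set

-- The r-expansion K_{ℓ+1}^{(r)+} of K_{ℓ+1}.
-- Vertices: ℓ+1 core vertices, and for each pair i<j of core vertices,
-- r-2 new vertices.  The edge for pair {i,j} is {i,j} ∪ (its r-2 new vertices).

CorePair : ℕ → Set
CorePair ℓ = Σ (Fin (suc ℓ) × Fin (suc ℓ)) (λ p → proj₁ p F.< proj₂ p)

ExpVertex : ℕ → ℕ → Set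
ExpVertex ℓ r = Fin (suc ℓ) ⊎ (CorePair ℓ × Fin (r ∸ 2))

ContainsExpansion : (ℓ r n : ℕ) → RGraph n → Set
ContainsExpansion ℓ r n H =
  Σ[ φ ∈ (ExpVertex ℓ r → Fin n) ] (Injective _≡_ _≡_ φ ×
    ((p : CorePair ℓ) → ∃[ e ] (H e ×
      ((x : Fin n) → x ∈ e ⇔
        (x ≡ φ (inj₁ (proj₁ (proj₁ p))) ⊎ x ≡ φ (inj₁ (proj₂ (proj₁ p)))
          ⊎ ∃[ k ] (x ≡ φ (inj₂ (p , k))))))))

ExpansionFree : (ℓ r n : ℕ) → RGraph n → Set
ExpansionFree ℓ r n H = ¬ ContainsExpansion ℓ r n H

-- floor and ceiling of s / k (k = 0 never occurs in use)

floorDiv : ℕ → ℕ → ℕ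
floorDiv s zero = zero
floorDiv s (suc k) = s / suc k

ceilDiv : ℕ → ℕ → ℕ
ceilDiv s zero = zero
ceilDiv s (suc k) = (s + k) / suc k

-- The constructions.  A : Subset n is the set A (|A| = s), B is its complement.

G1 : (ℓ r s n : ℕ) → Subset n → Fin n → RGraph n
G1 ℓ r s n A u e =
  ∣ e ∣ ≡ r × (∣ e ∩ A ∣ ≡ 1 ⊎ (u ∈ e × suc (s ∸ ((ℓ ∸ 1) C 2)) ≤ ∣ e ∩ A ∣))

-- G2(t): given a labelling part of A into parts A_1..A_k (A_i = {x ∈ A | part x = i}),
-- r-sets with exactly one vertex of A, or of the form {u_i,u_j} ∪ S with
-- u_i ∈ A_i, u_j ∈ A_j, i ≠ j, S an (r-2)-subset of B.
G2 : (r n k : ℕ) → Subset n → (Fin n → Fin k) → RGraph n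
G2 r n k A part e =
  ∣ e ∣ ≡ r × (∣ e ∩ A ∣ ≡ 1 ⊎
    ∃[ x ] ∃[ y ] (x ∈ A × y ∈ A × part x ≢ part y × x ∈ e × y ∈ e × ∣ e ∩ A ∣ ≡ 2))

G3 : (r n : ℕ) → Subset n → RGraph n
G3 r n A e = ∣ e ∣ ≡ r × 1 ≤ ∣ e ∩ A ∣

partSet : {n k : ℕ} → Subset n → (Fin n → Fin k) → Fin k → Subset n
partSet {n} A part i = A ∩ tabulate (λ x → ⌊ part x F.≟ i ⌋)

{-# OPTIONS --safe #-}
module Submission where

-- Let an embedding of K_{ℓ+1}^{(r)+} map k_A core vertices into A and k_B = ℓ + 1 − k_A
-- into B. Every edge of the three constructions meets A, so each of the C(k_B, 2) edges
-- between core vertices in B has a non-core vertex in A; these vertices are distinct from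
-- each other and from the core, whence k_A + C(k_B, 2) ≤ s, and the left side grows as
-- k_A decreases.
-- (c) k_A ≤ s < ℓ, so the bound gives ℓ ≤ s.
-- (b) An edge containing two core vertices in A meets A in exactly those two, which must
-- lie in different parts; so k_A ≤ ℓ − t, and the bound gives ℓ − t + C(t + 1, 2) ≤ s.
-- (a) k_A ≤ 1 would give ℓ + C(ℓ − 1, 2) ≤ s. Edges through two core vertices in A must
-- contain u, and no vertex of the expansion lies on all three edges of a triangle, so
-- k_A = 2. The edge e joining these two core vertices then has more than s − C(ℓ − 1, 2)
-- vertices in A, none of them among the C(ℓ − 1, 2) vertices found above: a contradiction.

open import Defs
open import Data.Empty using (⊥; ⊥-elim)
open import Data.Fin as Fin using (Fin; zero; suc; splitAt; inject≤)
open import Data.Fin.Patterns using (0F; 1F; 2F)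
open import Data.Fin.Properties as Finₚ using (+↔⊎; injective⇒≤; toℕ-inject≤; suc-injective)
open import Data.Fin.Subset using (Subset; Nonempty; _∈_; _∩_; _-_; ∣_∣; ∁; inside; outside)
open import Data.Fin.Subset.Properties
  using (x∈p∩q⁺; x∈p∩q⁻; x∈p⇒∣p-x∣<∣p∣; x∈p∧x≢y⇒x∈p-y; nonempty?; Empty-unique; ∣⊥∣≡0;
         x∈∁p⇒x∉p; ∣∁p∣≡n∸∣p∣; ∣p∣≤n)
open import Data.Nat as ℕ using (ℕ; zero; suc; _+_; _∸_; _≤_; _<_; z≤n; s≤s; z<s; s<s)
open import Data.Nat.Properties as ℕₚ
  using (≤-refl; ≤-trans; ≤-reflexive; <⇒≱; +-mono-≤; +-monoʳ-≤; module ≤-Reasoning)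
open import Data.Nat.Combinatorics using (_C_; nC1≡n; nCk+nC[k+1]≡[n+1]C[k+1])
open import Data.Product as Product using (∃-syntax; _×_; _,_; proj₁; proj₂)
open import Data.Sum as Sum using (_⊎_; inj₁; inj₂; [_,_]′)
open import Data.Sum.Properties using (inj₁-injective; inj₂-injective)
open import Data.Vec using (_∷_; here; there; tabulate; lookup)
open import Data.Vec.Properties using (lookup∘tabulate; []=⇒lookup; lookup⇒[]=)
open import Function using (_∘_)
open import Function.Bundles using (Injection; Equivalence)
open import Function.Definitions using (Injective)
open import Function.Properties.Inverse using (↔⇒↣)
open import Relation.Binary.Definitions using (tri<; tri≈; tri>)
open import Relation.Binary.PropositionalEquality
  using (_≡_; _≢_; refl; sym; trans; cong; cong₂; subst; subst₂; module ≡-Reasoning)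
open import Relation.Nullary using (yes; no)

private
  variable
    a b k n : ℕ

-- Counting elements of a subset

≢-on-<⇒injective : {B : Set} {f : Fin k → B} →
  (∀ {i j} → i Fin.< j → f i ≢ f j) → Injective _≡_ _≡_ f
≢-on-<⇒injective f≢ {i} {j} eq with Finₚ.<-cmp i j
... | tri< i<j _ _ = ⊥-elim (f≢ i<j eq)
... | tri≈ _ i≡j _ = i≡j
... | tri> _ _ j<i = ⊥-elim (f≢ j<i (sym eq))

[,]′-injective : {A B C : Set} {f : A → C} {g : B → C} →
  Injective _≡_ _≡_ f → Injective _≡_ _≡_ g → (∀ x y → f x ≢ g y) →
  Injective _≡_ _≡_ [ f , g ]′
[,]′-injective f-inj g-inj f≢g {inj₁ x} {inj₁ y} eq = cong inj₁ (f-inj eq)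
[,]′-injective f-inj g-inj f≢g {inj₁ x} {inj₂ y} eq = ⊥-elim (f≢g x y eq)
[,]′-injective f-inj g-inj f≢g {inj₂ x} {inj₁ y} eq = ⊥-elim (f≢g y x (sym eq))
[,]′-injective f-inj g-inj f≢g {inj₂ x} {inj₂ y} eq = cong inj₂ (g-inj eq)

splitAt-injective : ∀ a → Injective _≡_ _≡_ (splitAt a {b})
splitAt-injective a = Injection.injective (↔⇒↣ (+↔⊎ {a}))

enum : (p : Subset n) → Fin ∣ p ∣ → Fin n
enum (inside  ∷ p) zero    = zero
enum (inside  ∷ p) (suc i) = suc (enum p i)
enum (outside ∷ p) i       = suc (enum p i)

enum-∈ : (p : Subset n) (i : Fin ∣ p ∣) → enum p i ∈ p
enum-∈ (inside  ∷ p) zero    = here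
enum-∈ (inside  ∷ p) (suc i) = there (enum-∈ p i)
enum-∈ (outside ∷ p) i       = there (enum-∈ p i)

enum-mono : (p : Subset n) {i j : Fin ∣ p ∣} → i Fin.< j → enum p i Fin.< enum p j
enum-mono (inside  ∷ p) {zero}  {suc j} _         = z<s
enum-mono (inside  ∷ p) {suc i} {suc j} (s<s i<j) = s<s (enum-mono p i<j)
enum-mono (outside ∷ p)                 i<j       = s<s (enum-mono p i<j)

enum-injective : (p : Subset n) → Injective _≡_ _≡_ (enum p)
enum-injective p = ≢-on-<⇒injective λ i<j eq → Finₚ.<-irrefl eq (enum-mono p i<j)

rank : (p : Subset n) (x : Fin n) → x ∈ p → Fin ∣ p ∣
rank (inside  ∷ p) zero    here      = zero
rank (inside  ∷ p) (suc x) (there x∈p) = suc (rank p x x∈p)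
rank (outside ∷ p) (suc x) (there x∈p) = rank p x x∈p

enum-rank : (p : Subset n) (x : Fin n) (x∈p : x ∈ p) → enum p (rank p x x∈p) ≡ x
enum-rank (inside  ∷ p) zero    here        = refl
enum-rank (inside  ∷ p) (suc x) (there x∈p) = cong suc (enum-rank p x x∈p)
enum-rank (outside ∷ p) (suc x) (there x∈p) = cong suc (enum-rank p x x∈p)

injective⇒≤∣p∣ : {p : Subset n} {f : Fin a → Fin n} →
  Injective _≡_ _≡_ f → (∀ i → f i ∈ p) → a ≤ ∣ p ∣
injective⇒≤∣p∣ {p = p} {f} f-inj f∈p = injective⇒≤ {f = rank∘f} rank∘f-injective
  where
  rank∘f : Fin _ → Fin ∣ p ∣
  rank∘f i = rank p (f i) (f∈p i)

  rank∘f-injective : Injective _≡_ _≡_ rank∘f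
  rank∘f-injective {i} {j} eq = f-inj (begin
    f i                ≡⟨ enum-rank p (f i) (f∈p i) ⟨
    enum p (rank∘f i)  ≡⟨ cong (enum p) eq ⟩
    enum p (rank∘f j)  ≡⟨ enum-rank p (f j) (f∈p j) ⟩
    f j                ∎)
    where open ≡-Reasoning

disjoint-injective⇒+≤∣p∣ : {p : Subset n} {f : Fin a → Fin n} {g : Fin b → Fin n} →
  Injective _≡_ _≡_ f → Injective _≡_ _≡_ g → (∀ i j → f i ≢ g j) →
  (∀ i → f i ∈ p) → (∀ j → g j ∈ p) → a + b ≤ ∣ p ∣
disjoint-injective⇒+≤∣p∣ {a = a} {p = p} {f} {g} f-inj g-inj f≢g f∈p g∈p =
  injective⇒≤∣p∣ {p = p} {f = [ f , g ]′ ∘ splitAt a}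
    (splitAt-injective a ∘ [,]′-injective f-inj g-inj f≢g)
    (Sum.[_,_] {C = λ x → [ f , g ]′ x ∈ p} f∈p g∈p ∘ splitAt a)

1≤∣p∣⇒Nonempty : (p : Subset n) → 1 ≤ ∣ p ∣ → Nonempty p
1≤∣p∣⇒Nonempty {n} p 1≤∣p∣ with nonempty? p
... | yes p≢∅ = p≢∅
... | no  p≡∅ = ⊥-elim (<⇒≱ 1≤∣p∣ (≤-reflexive (trans (cong ∣_∣ (Empty-unique p≡∅)) (∣⊥∣≡0 n))))

x∈p∧k≤∣p-x∣⇒k<∣p∣ : {p : Subset n} {x : Fin n} → x ∈ p → k ≤ ∣ p - x ∣ → suc k ≤ ∣ p ∣
x∈p∧k≤∣p-x∣⇒k<∣p∣ x∈p k≤ = ℕₚ.≤-<-trans k≤ (x∈p⇒∣p-x∣<∣p∣ x∈p)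

distinct₂⇒2≤∣p∣ : {p : Subset n} {x y : Fin n} → x ∈ p → y ∈ p → x ≢ y → 2 ≤ ∣ p ∣
distinct₂⇒2≤∣p∣ x∈p y∈p x≢y =
  x∈p∧k≤∣p-x∣⇒k<∣p∣ x∈p (x∈p∧k≤∣p-x∣⇒k<∣p∣ (x∈p∧x≢y⇒x∈p-y y∈p (x≢y ∘ sym)) z≤n)

∣p∣≡2⇒∈-pair : {p : Subset n} {x y z : Fin n} → ∣ p ∣ ≡ 2 →
  x ∈ p → y ∈ p → x ≢ y → z ∈ p → z ≡ x ⊎ z ≡ y
∣p∣≡2⇒∈-pair {p = p} {x} {y} {z} ∣p∣≡2 x∈p y∈p x≢y z∈p with z Finₚ.≟ x | z Finₚ.≟ y
... | yes z≡x | _       = inj₁ z≡x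
... | no  _   | yes z≡y = inj₂ z≡y
... | no  z≢x | no  z≢y = ⊥-elim (<⇒≱ three≤∣p∣ (≤-reflexive ∣p∣≡2))
  where
  three≤∣p∣ : 3 ≤ ∣ p ∣
  three≤∣p∣ = x∈p∧k≤∣p-x∣⇒k<∣p∣ x∈p (x∈p∧k≤∣p-x∣⇒k<∣p∣ (x∈p∧x≢y⇒x∈p-y y∈p (x≢y ∘ sym))
                (x∈p∧k≤∣p-x∣⇒k<∣p∣ (x∈p∧x≢y⇒x∈p-y (x∈p∧x≢y⇒x∈p-y z∈p z≢x) z≢y) z≤n))

module _ (p : Subset n) (k≤∣p∣ : k ≤ ∣ p ∣) where

  pick : Fin k → Fin n
  pick i = enum p (inject≤ i k≤∣p∣)

  pick-∈ : ∀ i → pick i ∈ p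
  pick-∈ i = enum-∈ p (inject≤ i k≤∣p∣)

  pick-mono : ∀ {i j} → i Fin.< j → pick i Fin.< pick j
  pick-mono {i} {j} i<j = enum-mono p
    (subst₂ ℕ._<_ (sym (toℕ-inject≤ i k≤∣p∣)) (sym (toℕ-inject≤ j k≤∣p∣)) i<j)

-- Binomial coefficients n C 2

triangular : ℕ → ℕ
triangular zero    = zero
triangular (suc m) = m + triangular m

[1+m]C2≡m+mC2 : ∀ m → suc m C 2 ≡ m + m C 2
[1+m]C2≡m+mC2 m = trans (sym (nCk+nC[k+1]≡[n+1]C[k+1] m 1)) (cong (_+ m C 2) (nC1≡n m))

mC2≡triangular : ∀ m → m C 2 ≡ triangular m
mC2≡triangular zero    = refl
mC2≡triangular (suc m) = trans ([1+m]C2≡m+mC2 m) (cong (m +_) (mC2≡triangular m))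

orderedPairs : ∀ m → Fin (triangular m) → Fin m × Fin m
orderedPairs (suc m) =
  [ (λ j → zero , suc j) , Product.map suc suc ∘ orderedPairs m ]′ ∘ splitAt m

orderedPairs-< : ∀ m x → proj₁ (orderedPairs m x) Fin.< proj₂ (orderedPairs m x)
orderedPairs-< (suc m) x with splitAt m x
... | inj₁ j = z<s
... | inj₂ y = s<s (orderedPairs-< m y)

orderedPairs-injective : ∀ m → Injective _≡_ _≡_ (orderedPairs m)
orderedPairs-injective (suc m) = splitAt-injective m ∘
  [,]′-injective (suc-injective ∘ cong proj₂) (orderedPairs-injective m ∘ suc×suc-injective)
    (λ _ _ ())
  where
  suc×suc-injective : {i j : Fin m × Fin m} → Product.map suc suc i ≡ Product.map suc suc j → i ≡ j
  suc×suc-injective eq = cong₂ _,_ (suc-injective (cong proj₁ eq)) (suc-injective (cong proj₂ eq))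

m+[1+n]C2≤[m+1+n]C2 : ∀ m n → m + suc n C 2 ≤ (m + suc n) C 2
m+[1+n]C2≤[m+1+n]C2 zero    n = ≤-refl
m+[1+n]C2≤[m+1+n]C2 (suc m) n = begin
  1 + (m + suc n C 2)              ≤⟨ +-mono-≤ 1≤m+1+n (m+[1+n]C2≤[m+1+n]C2 m n) ⟩
  (m + suc n) + (m + suc n) C 2    ≡⟨ [1+m]C2≡m+mC2 (m + suc n) ⟨
  suc (m + suc n) C 2              ∎
  where
  open ≤-Reasoning
  1≤m+1+n : 1 ≤ m + suc n
  1≤m+1+n = ≤-trans (s≤s z≤n) (ℕₚ.m≤n+m (suc n) m)

-- x ↦ x + (1 + ℓ ∸ x) C 2 is antitone on x ≤ ℓ.
z+[1+t]C2≤x+yC2 : ∀ {x y z t} → x + y ≡ suc (z + t) → x ≤ z → z + suc t C 2 ≤ x + y C 2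
z+[1+t]C2≤x+yC2 {x} {y} {z} {t} x+y≡1+z+t x≤z with d , refl ← ℕₚ.m≤n⇒∃[o]m+o≡n x≤z = begin
  x + d + suc t C 2      ≡⟨ ℕₚ.+-assoc x d (suc t C 2) ⟩
  x + (d + suc t C 2)    ≤⟨ +-monoʳ-≤ x (m+[1+n]C2≤[m+1+n]C2 d t) ⟩
  x + (d + suc t) C 2    ≡⟨ cong (λ w → x + w C 2) y≡d+1+t ⟨
  x + y C 2              ∎
  where
  open ≤-Reasoning
  y≡d+1+t : y ≡ d + suc t
  y≡d+1+t = ℕₚ.+-cancelˡ-≡ x y (d + suc t) (begin-equality
    x + y                ≡⟨ x+y≡1+z+t ⟩
    suc (x + d + t)      ≡⟨ cong suc (ℕₚ.+-assoc x d t) ⟩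
    suc (x + (d + t))    ≡⟨ ℕₚ.+-suc x (d + t) ⟨
    x + suc (d + t)      ≡⟨ cong (x +_) (ℕₚ.+-suc d t) ⟨
    x + (d + suc t)      ∎)

x≤1⇒ℓ+[ℓ∸1]C2≤x+yC2 : ∀ {ℓ x y} → x + y ≡ suc ℓ → x ≤ 1 → ℓ + (ℓ ∸ 1) C 2 ≤ x + y C 2
x≤1⇒ℓ+[ℓ∸1]C2≤x+yC2 {zero}  _         _   = z≤n
x≤1⇒ℓ+[ℓ∸1]C2≤x+yC2 {suc ℓ} {x} {y} x+y≡2+ℓ x≤1 = begin
  suc ℓ + ℓ C 2       ≡⟨ cong suc ([1+m]C2≡m+mC2 ℓ) ⟨
  1 + suc ℓ C 2       ≤⟨ z+[1+t]C2≤x+yC2 x+y≡2+ℓ x≤1 ⟩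
  x + y C 2           ∎
  where open ≤-Reasoning

-- Embedded copies of the expansion

module Expansion (ℓ r : ℕ) where

  lo hi : CorePair ℓ → Fin (suc ℓ)
  lo = proj₁ ∘ proj₁
  hi = proj₂ ∘ proj₁

  pair : {i j : Fin (suc ℓ)} → i Fin.< j → CorePair ℓ
  pair {i} {j} i<j = (i , j) , i<j

  _∈ᴱ_ : ExpVertex ℓ r → CorePair ℓ → Set
  z ∈ᴱ p = z ≡ inj₁ (lo p) ⊎ z ≡ inj₁ (hi p) ⊎ ∃[ k ] z ≡ inj₂ (p , k)

  ∄-common-vertex-of-triangle :
    ∀ {i j k} (i<j : i Fin.< j) (i<k : i Fin.< k) (j<k : j Fin.< k) {z} →
    z ∈ᴱ pair i<j → z ∈ᴱ pair i<k → z ∈ᴱ pair j<k → ⊥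
  ∄-common-vertex-of-triangle i<j i<k j<k (inj₁ refl) _ (inj₁ refl) = Finₚ.<-irrefl refl i<j
  ∄-common-vertex-of-triangle i<j i<k j<k (inj₁ refl) _ (inj₂ (inj₁ refl)) = Finₚ.<-irrefl refl i<k
  ∄-common-vertex-of-triangle i<j i<k j<k (inj₂ (inj₁ refl)) (inj₁ refl) _ = Finₚ.<-irrefl refl i<j
  ∄-common-vertex-of-triangle i<j i<k j<k (inj₂ (inj₁ refl)) (inj₂ (inj₁ refl)) _ = Finₚ.<-irrefl refl j<k
  ∄-common-vertex-of-triangle i<j i<k j<k (inj₂ (inj₂ (_ , refl))) (inj₂ (inj₂ (_ , eq))) _ =
    Finₚ.<-irrefl (cong (hi ∘ proj₁) (inj₂-injective eq)) j<k

module Embedding {ℓ r n : ℕ} {H : RGraph n} (emb : ContainsExpansion ℓ r n H) where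

  open Expansion ℓ r public

  φ : ExpVertex ℓ r → Fin n
  φ = proj₁ emb

  φ-injective : Injective _≡_ _≡_ φ
  φ-injective = proj₁ (proj₂ emb)

  edge : CorePair ℓ → Subset n
  edge p = proj₁ (proj₂ (proj₂ emb) p)

  edge∈H : ∀ p → H (edge p)
  edge∈H p = proj₁ (proj₂ (proj₂ (proj₂ emb) p))

  ∈edge⇒ : ∀ p {x} → x ∈ edge p → ∃[ z ] (x ≡ φ z × z ∈ᴱ p)
  ∈edge⇒ p {x} x∈e with Equivalence.to (proj₂ (proj₂ (proj₂ (proj₂ emb) p)) x) x∈e
  ... | inj₁ x≡           = _ , x≡ , inj₁ refl
  ... | inj₂ (inj₁ x≡)      = _ , x≡ , inj₂ (inj₁ refl)
  ... | inj₂ (inj₂ (k , x≡)) = _ , x≡ , inj₂ (inj₂ (k , refl))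

  φ∈edge : ∀ p {z} → z ∈ᴱ p → φ z ∈ edge p
  φ∈edge p z∈p = Equivalence.from (proj₂ (proj₂ (proj₂ (proj₂ emb) p)) _)
    (Sum.map (cong φ) (Sum.map (cong φ) (Product.map₂ (cong φ))) z∈p)

  core : Fin (suc ℓ) → Fin n
  core i = φ (inj₁ i)

  core-injective : Injective _≡_ _≡_ core
  core-injective = inj₁-injective ∘ φ-injective

  core-<⇒≢ : ∀ {i j} → i Fin.< j → core i ≢ core j
  core-<⇒≢ i<j = Finₚ.<⇒≢ i<j ∘ core-injective

  core≢φ-inj₂ : ∀ {i q} → core i ≢ φ (inj₂ q)
  core≢φ-inj₂ eq with () ← φ-injective eq

  ∄-common-vertex : ∀ {i j k} (i<j : i Fin.< j) (i<k : i Fin.< k) (j<k : j Fin.< k) {x} →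
    x ∈ edge (pair i<j) → x ∈ edge (pair i<k) → x ∈ edge (pair j<k) → ⊥
  ∄-common-vertex i<j i<k j<k x∈₁ x∈₂ x∈₃
    with z₁ , refl , z₁∈ ← ∈edge⇒ _ x∈₁
    with z₂ , eq₂ , z₂∈ ← ∈edge⇒ _ x∈₂
    with z₃ , eq₃ , z₃∈ ← ∈edge⇒ _ x∈₃
    = ∄-common-vertex-of-triangle i<j i<k j<k z₁∈
        (subst (_∈ᴱ _) (φ-injective (sym eq₂)) z₂∈) (subst (_∈ᴱ _) (φ-injective (sym eq₃)) z₃∈)

  module Cover (A : Subset n) (covers : ∀ e → H e → 1 ≤ ∣ e ∩ A ∣) where

    coreInA : Subset (suc ℓ)
    coreInA = tabulate (lookup A ∘ core)

    coreInB : Subset (suc ℓ)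
    coreInB = ∁ coreInA

    ∈coreInA⁺ : ∀ {i} → core i ∈ A → i ∈ coreInA
    ∈coreInA⁺ {i} core∈A =
      lookup⇒[]= i coreInA (trans (lookup∘tabulate (lookup A ∘ core) i) ([]=⇒lookup core∈A))

    ∈coreInA⁻ : ∀ {i} → i ∈ coreInA → core i ∈ A
    ∈coreInA⁻ {i} i∈A =
      lookup⇒[]= (core i) A (trans (sym (lookup∘tabulate (lookup A ∘ core) i)) ([]=⇒lookup i∈A))

    kA kB : ℕ
    kA = ∣ coreInA ∣
    kB = ∣ coreInB ∣

    kA+kB≡1+ℓ : kA + kB ≡ suc ℓ
    kA+kB≡1+ℓ = trans (cong (kA +_) (∣∁p∣≡n∸∣p∣ coreInA)) (ℕₚ.m+[n∸m]≡n (∣p∣≤n coreInA))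

    witness : ∀ p → lo p ∈ coreInB → hi p ∈ coreInB → ∃[ k ] φ (inj₂ (p , k)) ∈ A
    witness p lo∈B hi∈B with 1≤∣p∣⇒Nonempty _ (covers _ (edge∈H p))
    ... | x , x∈e∩A with x∈p∩q⁻ (edge p) A x∈e∩A
    ... | x∈e , x∈A with ∈edge⇒ p x∈e
    ... | _ , refl , inj₁ refl             = ⊥-elim (x∈∁p⇒x∉p lo∈B (∈coreInA⁺ x∈A))
    ... | _ , refl , inj₂ (inj₁ refl)      = ⊥-elim (x∈∁p⇒x∉p hi∈B (∈coreInA⁺ x∈A))
    ... | _ , refl , inj₂ (inj₂ (k , refl)) = k , x∈A

    AvoidsWitnesses : Fin n → Set
    AvoidsWitnesses x = ∀ {p k} → lo p ∈ coreInB → x ≢ φ (inj₂ (p , k))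

    pairInB : Fin (triangular kB) → CorePair ℓ
    pairInB x =
      Product.map (enum coreInB) (enum coreInB) (orderedPairs kB x)
      , enum-mono coreInB (orderedPairs-< kB x)

    witnessOf : ∀ x → ∃[ k ] φ (inj₂ (pairInB x , k)) ∈ A
    witnessOf x = witness (pairInB x) (enum-∈ coreInB _) (enum-∈ coreInB _)

    witnessVertex : Fin (triangular kB) → Fin n
    witnessVertex x = φ (inj₂ (pairInB x , proj₁ (witnessOf x)))

    witnessVertex-∈A : ∀ x → witnessVertex x ∈ A
    witnessVertex-∈A x = proj₂ (witnessOf x)

    witnessVertex-injective : Injective _≡_ _≡_ witnessVertex
    witnessVertex-injective {x} {y} eq = orderedPairs-injective kB
      (cong₂ _,_ (enum-injective coreInB (cong lo same-pair))
                 (enum-injective coreInB (cong hi same-pair)))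
      where
      same-pair : pairInB x ≡ pairInB y
      same-pair = cong proj₁ (inj₂-injective (φ-injective eq))

    +kBC2≤∣A∣ : {f : Fin a → Fin n} → Injective _≡_ _≡_ f → (∀ i → f i ∈ A) →
      (∀ i → AvoidsWitnesses (f i)) → a + kB C 2 ≤ ∣ A ∣
    +kBC2≤∣A∣ {a} f-inj f∈A f-avoids = subst (λ c → a + c ≤ ∣ A ∣) (sym (mC2≡triangular kB))
      (disjoint-injective⇒+≤∣p∣ f-inj witnessVertex-injective (λ i _ → f-avoids i (enum-∈ coreInB _))
        f∈A witnessVertex-∈A)

    kA+kBC2≤∣A∣ : kA + kB C 2 ≤ ∣ A ∣
    kA+kBC2≤∣A∣ = +kBC2≤∣A∣ (enum-injective coreInA ∘ core-injective) (∈coreInA⁻ ∘ enum-∈ coreInA)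
      (λ _ _ → core≢φ-inj₂)

    core∈edge∩A : ∀ {p i} → i ∈ coreInA → inj₁ i ∈ᴱ p → core i ∈ edge p ∩ A
    core∈edge∩A i∈A i∈p = x∈p∩q⁺ (φ∈edge _ i∈p , ∈coreInA⁻ i∈A)

    2≤∣edge∩A∣ : ∀ {i j} (i<j : i Fin.< j) → i ∈ coreInA → j ∈ coreInA →
      2 ≤ ∣ edge (pair i<j) ∩ A ∣
    2≤∣edge∩A∣ i<j i∈A j∈A =
      distinct₂⇒2≤∣p∣ (core∈edge∩A i∈A (inj₁ refl)) (core∈edge∩A j∈A (inj₂ (inj₁ refl)))
        (core-<⇒≢ i<j)

    edge-avoidsWitnesses : ∀ {q x} → lo q ∈ coreInA → x ∈ edge q → AvoidsWitnesses x
    edge-avoidsWitnesses lo∈A x∈q lo∈B x≡ with ∈edge⇒ _ x∈q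
    ... | _ , refl , z∈q with φ-injective x≡
    ... | refl with z∈q
    ... | inj₂ (inj₂ (_ , eq)) =
      x∈∁p⇒x∉p lo∈B (subst (_∈ coreInA) (cong (lo ∘ proj₁) (inj₂-injective (sym eq))) lo∈A)

    kA≤∣A∣ : kA ≤ ∣ A ∣
    kA≤∣A∣ = ≤-trans (ℕₚ.m≤m+n kA (kB C 2)) kA+kBC2≤∣A∣

-- The three constructions

G3-expansionFree : ∀ {ℓ r n} (A : Subset n) → ∣ A ∣ < ℓ → ExpansionFree ℓ r n (G3 r n A)
G3-expansionFree {ℓ} {r} A ∣A∣<ℓ emb = <⇒≱ ∣A∣<ℓ (begin
  ℓ              ≡⟨ ℕₚ.+-identityʳ ℓ ⟨
  ℓ + 1 C 2      ≤⟨ z+[1+t]C2≤x+yC2 (trans kA+kB≡1+ℓ (cong suc (sym (ℕₚ.+-identityʳ ℓ))))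
                      (ℕₚ.<⇒≤ (ℕₚ.≤-<-trans kA≤∣A∣ ∣A∣<ℓ)) ⟩
  kA + kB C 2    ≤⟨ kA+kBC2≤∣A∣ ⟩
  ∣ A ∣          ∎)
  where
  open Embedding {r = r} emb
  open Cover A (λ _ → proj₂)
  open ≤-Reasoning

G2-expansionFree : ∀ {ℓ r n t} (A : Subset n) → t ≤ ℓ → ∣ A ∣ < ℓ ∸ t + (t + 1) C 2 →
  (part : Fin n → Fin (ℓ ∸ t)) → ExpansionFree ℓ r n (G2 r n (ℓ ∸ t) A part)
G2-expansionFree {ℓ} {r} {n} {t} A t≤ℓ ∣A∣< part emb = <⇒≱ ∣A∣< (begin
  ℓ ∸ t + (t + 1) C 2   ≡⟨ cong (λ w → ℓ ∸ t + w C 2) (ℕₚ.+-comm t 1) ⟩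
  ℓ ∸ t + suc t C 2     ≤⟨ z+[1+t]C2≤x+yC2 (trans kA+kB≡1+ℓ (cong suc (sym (ℕₚ.m∸n+n≡m t≤ℓ))))
                                            kA≤ℓ∸t ⟩
  kA + kB C 2           ≤⟨ kA+kBC2≤∣A∣ ⟩
  ∣ A ∣                 ∎)
  where
  covers : ∀ e → G2 r n (ℓ ∸ t) A part e → 1 ≤ ∣ e ∩ A ∣
  covers e (_ , inj₁ ∣e∩A∣≡1) = ≤-reflexive (sym ∣e∩A∣≡1)
  covers e (_ , inj₂ (_ , _ , _ , _ , _ , _ , _ , ∣e∩A∣≡2)) = subst (1 ≤_) (sym ∣e∩A∣≡2) (s≤s z≤n)

  open Embedding {r = r} emb
  open Cover A covers
  open ≤-Reasoning

  core-parts-distinct : ∀ {i j} (i<j : i Fin.< j) → i ∈ coreInA → j ∈ coreInA →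
    part (core i) ≢ part (core j)
  core-parts-distinct {i} {j} i<j i∈A j∈A same with proj₂ (edge∈H (pair i<j))
  ... | inj₁ ∣e∩A∣≡1 = <⇒≱ (2≤∣edge∩A∣ i<j i∈A j∈A) (≤-reflexive ∣e∩A∣≡1)
  ... | inj₂ (x , y , x∈A , y∈A , px≢py , x∈e , y∈e , ∣e∩A∣≡2) =
    px≢py (trans (part≡part-core-i x∈e x∈A) (sym (part≡part-core-i y∈e y∈A)))
    where
    part≡part-core-i : ∀ {z} → z ∈ edge (pair i<j) → z ∈ A → part z ≡ part (core i)
    part≡part-core-i z∈e z∈A with ∣p∣≡2⇒∈-pair ∣e∩A∣≡2 (core∈edge∩A i∈A (inj₁ refl))
      (core∈edge∩A j∈A (inj₂ (inj₁ refl))) (core-<⇒≢ i<j) (x∈p∩q⁺ (z∈e , z∈A))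
    ... | inj₁ refl = refl
    ... | inj₂ refl = sym same

  kA≤ℓ∸t : kA ≤ ℓ ∸ t
  kA≤ℓ∸t = injective⇒≤ {f = part ∘ core ∘ enum coreInA} (≢-on-<⇒injective λ i<j →
    core-parts-distinct (enum-mono coreInA i<j) (enum-∈ coreInA _) (enum-∈ coreInA _))

G1-expansionFree : ∀ {ℓ r s n} (A : Subset n) (u : Fin n) → ∣ A ∣ ≡ s → r ≤ ℓ →
  (ℓ ∸ 1) C 2 ≤ s → s < r + (ℓ ∸ 1) C 2 → ExpansionFree ℓ r n (G1 ℓ r s n A u)
G1-expansionFree {ℓ} {r} {_} {n} A u refl r≤ℓ C≤∣A∣ ∣A∣< emb = ℕₚ.<-irrefl refl (begin-strict
  ∣ A ∣                                ≡⟨ ℕₚ.m∸n+n≡m C≤∣A∣ ⟨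
  ∣ A ∣ ∸ (ℓ ∸ 1) C 2 + (ℓ ∸ 1) C 2    <⟨ ≤-refl ⟩
  suc (∣ A ∣ ∸ (ℓ ∸ 1) C 2) + (ℓ ∸ 1) C 2
                                       ≤⟨ ℕₚ.+-monoˡ-≤ ((ℓ ∸ 1) C 2) (proj₂ (edge-type-two i<j i∈A j∈A)) ⟩
  ∣ e ∩ A ∣ + (ℓ ∸ 1) C 2              ≡⟨ cong (λ w → ∣ e ∩ A ∣ + w C 2) kB≡ℓ∸1 ⟨
  ∣ e ∩ A ∣ + kB C 2                   ≤⟨ +kBC2≤∣A∣ (enum-injective (e ∩ A)) (proj₂ ∘ ∈e∩A)
                                             (λ x → edge-avoidsWitnesses i∈A (proj₁ (∈e∩A x))) ⟩
  ∣ A ∣                                ∎)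
  where
  covers : ∀ e → G1 ℓ r ∣ A ∣ n A u e → 1 ≤ ∣ e ∩ A ∣
  covers e (_ , inj₁ ∣e∩A∣≡1) = ≤-reflexive (sym ∣e∩A∣≡1)
  covers e (_ , inj₂ (_ , big)) = ≤-trans (s≤s z≤n) big

  open Embedding {r = r} emb
  open Cover A covers
  open ≤-Reasoning

  edge-type-two : ∀ {i j} (i<j : i Fin.< j) → i ∈ coreInA → j ∈ coreInA →
    u ∈ edge (pair i<j) × suc (∣ A ∣ ∸ (ℓ ∸ 1) C 2) ≤ ∣ edge (pair i<j) ∩ A ∣
  edge-type-two i<j i∈A j∈A with proj₂ (edge∈H (pair i<j))
  ... | inj₁ ∣e∩A∣≡1 = ⊥-elim (<⇒≱ (2≤∣edge∩A∣ i<j i∈A j∈A) (≤-reflexive ∣e∩A∣≡1))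
  ... | inj₂ big     = big

  kA≤2 : kA ≤ 2
  kA≤2 with kA ℕ.≤? 2
  ... | yes kA≤2 = kA≤2
  ... | no  kA≰2 = ⊥-elim (∄-common-vertex _ _ _
    (u∈edge {0F} {1F} z<s) (u∈edge {0F} {2F} z<s) (u∈edge {1F} {2F} (s<s z<s)))
    where
    3≤kA : 3 ≤ kA
    3≤kA = ℕₚ.≰⇒> kA≰2

    u∈edge : ∀ {a b} (a<b : a Fin.< b) → u ∈ edge (pair (pick-mono coreInA 3≤kA a<b))
    u∈edge {a} {b} a<b =
      proj₁ (edge-type-two (pick-mono coreInA 3≤kA a<b)
                           (pick-∈ coreInA 3≤kA a) (pick-∈ coreInA 3≤kA b))

  2≤kA : 2 ≤ kA
  2≤kA with 2 ℕ.≤? kA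
  ... | yes 2≤kA = 2≤kA
  ... | no  2≰kA = ⊥-elim (<⇒≱ ∣A∣< (begin
    r + (ℓ ∸ 1) C 2    ≤⟨ ℕₚ.+-monoˡ-≤ ((ℓ ∸ 1) C 2) r≤ℓ ⟩
    ℓ + (ℓ ∸ 1) C 2    ≤⟨ x≤1⇒ℓ+[ℓ∸1]C2≤x+yC2 kA+kB≡1+ℓ (ℕₚ.≤-pred (ℕₚ.≰⇒> 2≰kA)) ⟩
    kA + kB C 2        ≤⟨ kA+kBC2≤∣A∣ ⟩
    ∣ A ∣              ∎))

  kB≡ℓ∸1 : kB ≡ ℓ ∸ 1
  kB≡ℓ∸1 = cong (_∸ 2) (trans (cong (_+ kB) (ℕₚ.≤-antisym 2≤kA kA≤2)) kA+kB≡1+ℓ)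

  i j : Fin (suc ℓ)
  i = pick coreInA 2≤kA 0F
  j = pick coreInA 2≤kA 1F

  i<j : i Fin.< j
  i<j = pick-mono coreInA 2≤kA z<s

  i∈A : i ∈ coreInA
  i∈A = pick-∈ coreInA 2≤kA 0F

  j∈A : j ∈ coreInA
  j∈A = pick-∈ coreInA 2≤kA 1F

  e : Subset n
  e = edge (pair i<j)

  ∈e∩A : ∀ x → enum (e ∩ A) x ∈ e × enum (e ∩ A) x ∈ A
  ∈e∩A x = x∈p∩q⁻ e A (enum-∈ (e ∩ A) x)

proposition4p4 :
    (ℓ r s n : ℕ) → 3 ≤ r → r ≤ ℓ → 1 ≤ s → s < n →
    (A : Subset n) → ∣ A ∣ ≡ s →
      ((2 + ((ℓ ∸ 1) C 2) ≤ s → s < r + ((ℓ ∸ 1) C 2) →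
          (u : Fin n) → u ∈ A → ExpansionFree ℓ r n (G1 ℓ r s n A u))
      × ((t : ℕ) → 2 ≤ t → t ≤ ℓ ∸ 2 →
          (ℓ + 1 ∸ t) + (t C 2) ≤ s → s < (ℓ ∸ t) + ((t + 1) C 2) →
          (part : Fin n → Fin (ℓ ∸ t)) →
          ((i : Fin (ℓ ∸ t)) →
             ∣ partSet A part i ∣ ≡ floorDiv s (ℓ ∸ t)
             ⊎ ∣ partSet A part i ∣ ≡ ceilDiv s (ℓ ∸ t)) →
          ExpansionFree ℓ r n (G2 r n (ℓ ∸ t) A part))
      × (s < ℓ → ExpansionFree ℓ r n (G3 r n A)))
proposition4p4 ℓ r _ n _ r≤ℓ _ _ A refl =
    (λ 2+C≤s s<r+C u _ → G1-expansionFree A u refl r≤ℓ (≤-trans (ℕₚ.m≤n+m _ 2) 2+C≤s) s<r+C)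
  , (λ t _ t≤ℓ∸2 _ s<ℓ∸t+[t+1]C2 part _ →
       G2-expansionFree A (≤-trans t≤ℓ∸2 (ℕₚ.m∸n≤m ℓ 2)) s<ℓ∸t+[t+1]C2 part)
  , G3-expansionFree A
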